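{- Each of the following axioms (for all $a\in A$ and $\alpha,\beta\in A\cup\{\tau\}$) is derivable in equational logic from A1–A4, WF1, WFE2, WFE3: WF1 $ax+ay\approx a(\tau x+\tau y)$; WF2$^a$ $\tau(x+y)+\tau x+y\approx\tau x+y$; WF2$^b$ $\alpha(\tau(x+y)+z)+\alpha(\tau x+y+z)\approx\alpha(\tau x+y+z)$; WF3$^a$ $x+\tau x+y\approx\tau x+y$; WF3$^b$ $\alpha(x+z)+\alpha(\tau x+y+z)\approx\alpha(\tau x+y+z)$; RS $\beta(\alpha x+z)+\beta(\alpha x+\alpha y+z)\approx\beta(\alpha x+\alpha y+z)$. Moreover, if $A$ is finite, then also the axioms WF$_A^{~a}$ $\sum_{a\in A}ax_a+\sum_{a\in A}ax_a+y\approx\sum_{a\in A}ax_a+y$ and WF$_A^{~b}$ $\beta(\sum_{a\in A}ax_a+z)+\beta(\sum_{a\in A}ax_a+y+z)\approx\beta(\sum_{a\in A}ax_a+y+z)$ ($\beta\in A\cup\{\tau\}$) are derivable from A1–A4, WF1, WFE2, WFE3 and WFE$_A$.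
   Context: $\mathrm{BCCS}(A)$ terms over a nonempty action set $A$, silent action $\tau\notin A$, countably infinite variable set: $t::=\mathbf{0}\mid\alpha t\mid t+t\mid x$. Equational logic: reflexivity, symmetry, transitivity, substitution, closure under BCCS operators. Axioms: A1 $x+y\approx y+x$; A2 $(x+y)+z\approx x+(y+z)$; A3 $x+x\approx x$; A4 $x+\mathbf{0}\approx x$; WF1 $ax+ay\approx a(\tau x+\tau y)$ ($a\in A$); WFE2 $\tau(x+y)+\tau x\approx\tau x+y$; WFE3 $ax+\tau(ay+z)\approx\tau(ax+ay+z)$ ($a\in A$); WFE$_A$ (for finite $A$) $\tau(\sum_{a\in A}ax_a+z)+\tau(\sum_{a\in A}ax_a+y+z)\approx\tau(\sum_{a\in A}ax_a+y+z)$, with the $x_a$, $y$, $z$ distinct variables. -}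

module Defs where

open import Data.Nat using (ℕ; zero; suc)
open import Data.List using (List; []; _∷_)

data Lab (Act : Set) : Set where
  act : Act → Lab Act
  τ   : Lab Act

infixr 7 _·_
infixl 6 _⊕_
data Term (Act : Set) : Set where
  𝟎   : Term Act
  _·_ : Lab Act → Term Act → Term Act
  _⊕_ : Term Act → Term Act → Term Act
  var : ℕ → Term Act

module _ {Act : Set} where

  infix 4 _⊢_≈_
  infixl 8 _[_]

  _[_] : Term Act → (ℕ → Term Act) → Term Act
  𝟎 [ σ ] = 𝟎
  (α · t) [ σ ] = α · (t [ σ ])
  (t ⊕ u) [ σ ] = (t [ σ ]) ⊕ (u [ σ ])
  var n [ σ ] = σ n

  data _⊢_≈_ (E : Term Act → Term Act → Set) : Term Act → Term Act → Set where
    ax     : ∀ {t u} → E t u → E ⊢ t ≈ u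
    refl   : ∀ {t} → E ⊢ t ≈ t
    sym    : ∀ {t u} → E ⊢ t ≈ u → E ⊢ u ≈ t
    trans  : ∀ {t u v} → E ⊢ t ≈ u → E ⊢ u ≈ v → E ⊢ t ≈ v
    subst  : ∀ {t u} (σ : ℕ → Term Act) → E ⊢ t ≈ u → E ⊢ t [ σ ] ≈ u [ σ ]
    pre    : ∀ {t u} (α : Lab Act) → E ⊢ t ≈ u → E ⊢ α · t ≈ α · u
    plus   : ∀ {t t' u u'} → E ⊢ t ≈ t' → E ⊢ u ≈ u' → E ⊢ t ⊕ u ≈ t' ⊕ u'

  x y z : Term Act
  x = var 0
  y = var 1
  z = var 2

  -- Σ_{a∈A} a x_a, for A enumerated (without repetition) by a list;
  -- the i-th action of the list (counting from 0) gets variable x_a = var (k + i).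
  -- Starting from k = 3 the x_a are distinct from each other and from x, y, z.
  sumFrom : ℕ → List Act → Term Act
  sumFrom k [] = 𝟎
  sumFrom k (a ∷ as) = act a · var k ⊕ sumFrom (suc k) as

  ΣAx : List Act → Term Act
  ΣAx enum = sumFrom 3 enum

  data Base : Term Act → Term Act → Set where
    A1   : Base (x ⊕ y) (y ⊕ x)
    A2   : Base ((x ⊕ y) ⊕ z) (x ⊕ (y ⊕ z))
    A3   : Base (x ⊕ x) x
    A4   : Base (x ⊕ 𝟎) x
    WF1  : (a : Act) → Base (act a · x ⊕ act a · y) (act a · (τ · x ⊕ τ · y))
    WFE2 : Base (τ · (x ⊕ y) ⊕ τ · x) (τ · x ⊕ y)
    WFE3 : (a : Act) → Base (act a · x ⊕ τ · (act a · y ⊕ z))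
                            (τ · (act a · x ⊕ act a · y ⊕ z))

  data WithFin (enum : List Act) : Term Act → Term Act → Set where
    base : ∀ {t u} → Base t u → WithFin enum t u
    WFEA : WithFin enum (τ · (ΣAx enum ⊕ z) ⊕ τ · (ΣAx enum ⊕ y ⊕ z))
                        (τ · (ΣAx enum ⊕ y ⊕ z))

-- Write p ⊑ q for p ⊕ q ≈ q ("p is a summand of q"); it is a preorder compatible with ⊕.
-- WFE2 with x = y gives p ⊑ τ p, and from this every term of the form τ p ⊕ q is
-- τ-stable: τ (τ p ⊕ q) ≈ τ p ⊕ q.  Each of WF2ᵇ, WF3ᵇ, RS and WF_Aᵇ says that
-- β Q ⊑ β P; for β = τ this reduces, after removing the outer τ by τ-stability, to
-- a summand inclusion following from WFE2 (or WFE3 for RS with a visible α), and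
-- WF1 turns τ Q ⊑ τ P into a Q ⊑ a P for every visible a.
module Submission where

open import Defs
open import Data.Product using (_×_; _,_)
open import Data.List using (List)
open import Data.List.Membership.Propositional using (_∈_)
open import Data.List.Relation.Unary.Unique.Propositional using (Unique)
open import Data.Nat using (ℕ; zero; suc)
open import Level using (0ℓ)
open import Relation.Binary.Bundles using (Setoid)

module Derived {Act : Set} (E : Term Act → Term Act → Set)
               (base : ∀ {t u} → Base t u → E t u) where

  infix 4 _≋_ _⊑_

  _≋_ : Term Act → Term Act → Set
  p ≋ q = E ⊢ p ≈ q

  ≋-setoid : Setoid 0ℓ 0ℓ
  ≋-setoid = record
    { Carrier       = Term Act
    ; _≈_           = _≋_
    ; isEquivalence = record { refl = refl ; sym = sym ; trans = trans }
    }

  open import Relation.Binary.Reasoning.Setoid ≋-setoid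

  _⊑_ : Term Act → Term Act → Set
  p ⊑ q = p ⊕ q ≋ q

  instantiate : Term Act → Term Act → Term Act → ℕ → Term Act
  instantiate p q r zero          = p
  instantiate p q r (suc zero)    = q
  instantiate p q r (suc (suc _)) = r

  axiom : ∀ {t u} (p q r : Term Act) → Base t u → E ⊢ t [ instantiate p q r ] ≈ u [ instantiate p q r ]
  axiom p q r b = subst (instantiate p q r) (ax (base b))

  ⊕-congˡ : ∀ {p q} r → p ≋ q → r ⊕ p ≋ r ⊕ q
  ⊕-congˡ r e = plus refl e

  ⊕-congʳ : ∀ {p q} r → p ≋ q → p ⊕ r ≋ q ⊕ r
  ⊕-congʳ r e = plus e refl

  ⊕-comm : ∀ p q → p ⊕ q ≋ q ⊕ p
  ⊕-comm p q = axiom p q 𝟎 A1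

  ⊕-assoc : ∀ p q r → p ⊕ q ⊕ r ≋ p ⊕ (q ⊕ r)
  ⊕-assoc p q r = axiom p q r A2

  ⊕-idem : ∀ p → p ⊕ p ≋ p
  ⊕-idem p = axiom p 𝟎 𝟎 A3

  ⊕-idemʳ : ∀ p q → p ⊕ q ⊕ q ≋ p ⊕ q
  ⊕-idemʳ p q = trans (⊕-assoc p q q) (⊕-congˡ p (⊕-idem q))

  ⊕-interchange : ∀ p q r s → (p ⊕ q) ⊕ (r ⊕ s) ≋ (p ⊕ r) ⊕ (q ⊕ s)
  ⊕-interchange p q r s = begin
    (p ⊕ q) ⊕ (r ⊕ s) ≈⟨ ⊕-assoc p q (r ⊕ s) ⟩
    p ⊕ (q ⊕ (r ⊕ s)) ≈⟨ ⊕-congˡ p (⊕-assoc q r s) ⟨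
    p ⊕ (q ⊕ r ⊕ s)   ≈⟨ ⊕-congˡ p (⊕-congʳ s (⊕-comm q r)) ⟩
    p ⊕ (r ⊕ q ⊕ s)   ≈⟨ ⊕-congˡ p (⊕-assoc r q s) ⟩
    p ⊕ (r ⊕ (q ⊕ s)) ≈⟨ ⊕-assoc p r (q ⊕ s) ⟨
    (p ⊕ r) ⊕ (q ⊕ s) ∎

  wf1 : ∀ a p q → act a · p ⊕ act a · q ≋ act a · (τ · p ⊕ τ · q)
  wf1 a p q = axiom p q 𝟎 (WF1 a)

  wfe2 : ∀ p q → τ · (p ⊕ q) ⊕ τ · p ≋ τ · p ⊕ q
  wfe2 p q = axiom p q 𝟎 WFE2

  wfe3 : ∀ a p q r → act a · p ⊕ τ · (act a · q ⊕ r) ≋ τ · (act a · p ⊕ act a · q ⊕ r)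
  wfe3 a p q r = axiom p q r (WFE3 a)

  ⊑-trans : ∀ {p q r} → p ⊑ q → q ⊑ r → p ⊑ r
  ⊑-trans {p} {q} {r} p⊑q q⊑r = begin
    p ⊕ r       ≈⟨ ⊕-congˡ p q⊑r ⟨
    p ⊕ (q ⊕ r) ≈⟨ ⊕-assoc p q r ⟨
    p ⊕ q ⊕ r   ≈⟨ ⊕-congʳ r p⊑q ⟩
    q ⊕ r       ≈⟨ q⊑r ⟩
    r           ∎

  ⊑-antisym : ∀ {p q} → p ⊑ q → q ⊑ p → p ≋ q
  ⊑-antisym {p} {q} p⊑q q⊑p = trans (sym q⊑p) (trans (⊕-comm q p) p⊑q)

  ⊑-respˡ : ∀ {p p' q} → p ≋ p' → p ⊑ q → p' ⊑ q
  ⊑-respˡ {q = q} e p⊑q = trans (⊕-congʳ q (sym e)) p⊑q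

  ⊑-respʳ : ∀ {p q q'} → q ≋ q' → p ⊑ q → p ⊑ q'
  ⊑-respʳ {p} e p⊑q = trans (⊕-congˡ p (sym e)) (trans p⊑q e)

  ⊑-⊕ʳ : ∀ p q → p ⊑ p ⊕ q
  ⊑-⊕ʳ p q = trans (sym (⊕-assoc p p q)) (⊕-congʳ q (⊕-idem p))

  ⊑-monoʳ : ∀ {p q} r → p ⊑ q → p ⊕ r ⊑ q ⊕ r
  ⊑-monoʳ {p} {q} r p⊑q = begin
    (p ⊕ r) ⊕ (q ⊕ r) ≈⟨ ⊕-interchange p r q r ⟩
    (p ⊕ q) ⊕ (r ⊕ r) ≈⟨ plus p⊑q (⊕-idem r) ⟩
    q ⊕ r             ∎

  ⊑-⊕-middle : ∀ p q r → p ⊕ r ⊑ p ⊕ q ⊕ r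
  ⊑-⊕-middle p q r = ⊑-monoʳ r (⊑-⊕ʳ p q)

  -- WF1 moves an absorption under τ to one under any visible prefix.
  ⊑-prefix : ∀ α {q p} → τ · q ⊑ τ · p → α · q ⊑ α · p
  ⊑-prefix τ       τq⊑τp = τq⊑τp
  ⊑-prefix (act a) {q} {p} τq⊑τp = begin
    act a · q ⊕ act a · p   ≈⟨ wf1 a q p ⟩
    act a · (τ · q ⊕ τ · p) ≈⟨ pre (act a) τq⊑τp ⟩
    act a · (τ · p)         ≈⟨ pre (act a) (⊕-idem (τ · p)) ⟨
    act a · (τ · p ⊕ τ · p) ≈⟨ wf1 a p p ⟨
    act a · p ⊕ act a · p   ≈⟨ ⊕-idem (act a · p) ⟩
    act a · p               ∎

  p⊑τp : ∀ p → p ⊑ τ · p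
  p⊑τp p = begin
    p ⊕ τ · p           ≈⟨ ⊕-comm p (τ · p) ⟩
    τ · p ⊕ p           ≈⟨ wfe2 p p ⟨
    τ · (p ⊕ p) ⊕ τ · p ≈⟨ ⊕-congʳ (τ · p) (pre τ (⊕-idem p)) ⟩
    τ · p ⊕ τ · p       ≈⟨ ⊕-idem (τ · p) ⟩
    τ · p               ∎

  τ[p⊕q]⊑τp⊕q : ∀ p q → τ · (p ⊕ q) ⊑ τ · p ⊕ q
  τ[p⊕q]⊑τp⊕q p q = begin
    τ · (p ⊕ q) ⊕ (τ · p ⊕ q) ≈⟨ ⊕-assoc (τ · (p ⊕ q)) (τ · p) q ⟨
    τ · (p ⊕ q) ⊕ τ · p ⊕ q   ≈⟨ ⊕-congʳ q (wfe2 p q) ⟩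
    τ · p ⊕ q ⊕ q             ≈⟨ ⊕-idemʳ (τ · p) q ⟩
    τ · p ⊕ q                 ∎

  τ-stable : ∀ p q → τ · (τ · p ⊕ q) ≋ τ · p ⊕ q
  τ-stable p q = ⊑-antisym τX⊑X (p⊑τp X)
    where
    X = τ · p ⊕ q

    τp⊑X : τ · p ⊑ X
    τp⊑X = ⊑-⊕ʳ (τ · p) q

    τX⊕τp≋X : τ · X ⊕ τ · p ≋ X
    τX⊕τp≋X = begin
      τ · X ⊕ τ · p       ≈⟨ ⊕-congʳ (τ · p) (pre τ (⊑-trans (p⊑τp p) τp⊑X)) ⟨
      τ · (p ⊕ X) ⊕ τ · p ≈⟨ wfe2 p X ⟩
      τ · p ⊕ X           ≈⟨ τp⊑X ⟩
      X                   ∎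

    τX⊑X : τ · X ⊑ X
    τX⊑X = begin
      τ · X ⊕ (τ · p ⊕ q) ≈⟨ ⊕-assoc (τ · X) (τ · p) q ⟨
      τ · X ⊕ τ · p ⊕ q   ≈⟨ ⊕-congʳ q τX⊕τp≋X ⟩
      X ⊕ q               ≈⟨ ⊕-idemʳ (τ · p) q ⟩
      X                   ∎

  τ-stable₃ : ∀ p q r → τ · (τ · p ⊕ q ⊕ r) ≋ τ · p ⊕ q ⊕ r
  τ-stable₃ p q r = begin
    τ · (τ · p ⊕ q ⊕ r)   ≈⟨ pre τ (⊕-assoc (τ · p) q r) ⟩
    τ · (τ · p ⊕ (q ⊕ r)) ≈⟨ τ-stable p (q ⊕ r) ⟩
    τ · p ⊕ (q ⊕ r)       ≈⟨ ⊕-assoc (τ · p) q r ⟨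
    τ · p ⊕ q ⊕ r         ∎

  wf2ᵃ : ∀ p q → τ · (p ⊕ q) ⊕ τ · p ⊕ q ≋ τ · p ⊕ q
  wf2ᵃ p q = trans (⊕-congʳ q (wfe2 p q)) (⊕-idemʳ (τ · p) q)

  wf3ᵃ : ∀ p q → p ⊕ τ · p ⊕ q ≋ τ · p ⊕ q
  wf3ᵃ p q = ⊕-congʳ q (p⊑τp p)

  wf2ᵇ : ∀ α p q r → α · (τ · (p ⊕ q) ⊕ r) ⊑ α · (τ · p ⊕ q ⊕ r)
  wf2ᵇ α p q r = ⊑-prefix α
    (⊑-respˡ (sym (τ-stable (p ⊕ q) r))
      (⊑-respʳ (sym (τ-stable₃ p q r))
        (⊑-monoʳ r (τ[p⊕q]⊑τp⊕q p q))))

  wf3ᵇ : ∀ α p q r → α · (p ⊕ r) ⊑ α · (τ · p ⊕ q ⊕ r)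
  wf3ᵇ α p q r = ⊑-prefix α
    (⊑-respʳ (sym (τ-stable₃ p q r))
      (⊑-trans (τ[p⊕q]⊑τp⊕q p r) (⊑-⊕-middle (τ · p) q r)))

  rs-τ : ∀ α p q r → τ · (α · p ⊕ r) ⊑ τ · (α · p ⊕ α · q ⊕ r)
  rs-τ τ p q r =
    ⊑-respˡ (sym (τ-stable p r))
      (⊑-respʳ (sym (τ-stable₃ p (τ · q) r))
        (⊑-⊕-middle (τ · p) (τ · q) r))
  rs-τ (act a) p q r = begin
    τ · Q ⊕ τ · P                    ≈⟨ ⊕-comm (τ · Q) (τ · P) ⟩
    τ · P ⊕ τ · Q                    ≈⟨ ⊕-congʳ (τ · Q) (pre τ P≋Q⊕aq) ⟩
    τ · (Q ⊕ act a · q) ⊕ τ · Q      ≈⟨ wfe2 Q (act a · q) ⟩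
    τ · Q ⊕ act a · q                ≈⟨ ⊕-comm (τ · Q) (act a · q) ⟩
    act a · q ⊕ τ · Q                ≈⟨ wfe3 a q p r ⟩
    τ · (act a · q ⊕ act a · p ⊕ r)  ≈⟨ pre τ (⊕-congʳ r (⊕-comm (act a · q) (act a · p))) ⟩
    τ · P                            ∎
    where
    Q = act a · p ⊕ r
    P = act a · p ⊕ act a · q ⊕ r

    P≋Q⊕aq : P ≋ Q ⊕ act a · q
    P≋Q⊕aq = begin
      act a · p ⊕ act a · q ⊕ r   ≈⟨ ⊕-assoc (act a · p) (act a · q) r ⟩
      act a · p ⊕ (act a · q ⊕ r) ≈⟨ ⊕-congˡ (act a · p) (⊕-comm (act a · q) r) ⟩
      act a · p ⊕ (r ⊕ act a · q) ≈⟨ ⊕-assoc (act a · p) r (act a · q) ⟨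
      Q ⊕ act a · q               ∎

  rs : ∀ α β p q r → β · (α · p ⊕ r) ⊑ β · (α · p ⊕ α · q ⊕ r)
  rs α β p q r = ⊑-prefix β (rs-τ α p q r)

lemma4 : (Act : Set) → Act →
    ((a : Act) → Base ⊢ act a · x ⊕ act a · y ≈ act a · (τ · x ⊕ τ · y))
    × (Base {Act} ⊢ τ · (x ⊕ y) ⊕ τ · x ⊕ y ≈ τ · x ⊕ y)
    × ((α : Lab Act) → Base ⊢ α · (τ · (x ⊕ y) ⊕ z) ⊕ α · (τ · x ⊕ y ⊕ z) ≈ α · (τ · x ⊕ y ⊕ z))
    × (Base {Act} ⊢ x ⊕ τ · x ⊕ y ≈ τ · x ⊕ y)
    × ((α : Lab Act) → Base ⊢ α · (x ⊕ z) ⊕ α · (τ · x ⊕ y ⊕ z) ≈ α · (τ · x ⊕ y ⊕ z))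
    × ((α β : Lab Act) → Base ⊢ β · (α · x ⊕ z) ⊕ β · (α · x ⊕ α · y ⊕ z) ≈ β · (α · x ⊕ α · y ⊕ z))
    × ((enum : List Act) → (∀ a → a ∈ enum) → Unique enum →
    (WithFin enum ⊢ ΣAx enum ⊕ ΣAx enum ⊕ y ≈ ΣAx enum ⊕ y)
    × ((β : Lab Act) → WithFin enum ⊢ β · (ΣAx enum ⊕ z) ⊕ β · (ΣAx enum ⊕ y ⊕ z) ≈ β · (ΣAx enum ⊕ y ⊕ z)))
lemma4 Act _ =
    (λ a → B.wf1 a x y)
  , B.wf2ᵃ x y
  , (λ α → B.wf2ᵇ α x y z)
  , B.wf3ᵃ x y
  , (λ α → B.wf3ᵇ α x y z)
  , (λ α β → B.rs α β x y z)
  , λ enum _ _ → F.⊕-congʳ enum y (F.⊕-idem enum (ΣAx enum))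
               , (λ β → F.⊑-prefix enum β (ax WFEA))
  where
  module B = Derived {Act} Base (λ b → b)
  module F enum = Derived {Act} (WithFin enum) base
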